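{- Let $c,m,n$ be positive integers with $m\le n$. Then: (1) $L_{c,m,n}$ is a multiple of the rational number \[\frac{\prod_{k=m}^{n}(k^2+c)}{c\cdot(n-m)!\prod_{k=1}^{n-m}(k^2+4c)};\] (2) $L_{c,m,n}\ge \lambda_1(c)\cdot m^2\dfrac{n!^2}{m!^2(n-m)!^3}$, where $\lambda_1(c):=e^{ -\frac{2\pi^2}{3}c}/c$.
   Context: $L_{c,m,n}:=\mathrm{lcm}\{m^2+c,(m+1)^2+c,\dots,n^2+c\}$. An integer $a$ is said to be a multiple of a nonzero rational number $r$ if $a/r$ is an integer. An empty product equals $1$. -}

module Defs where

open import Data.Nat as ℕ using (ℕ; zero; suc; _∸_; _≤_)
open import Data.Nat.LCM using (lcm)
open import Data.List using (List; foldr; map; applyUpTo)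
open import Data.Integer as ℤ using (ℤ; +_)
open import Data.Rational as ℚ using (ℚ; _/_; 0ℚ; 1ℚ)
open import Data.Product using (∃-syntax; _×_)
open import Relation.Binary.PropositionalEquality using (_≡_)

-- the list [m, m+1, ..., n]  (empty if n < m)
range : ℕ → ℕ → List ℕ
range m n = applyUpTo (λ i → m ℕ.+ i) (suc n ∸ m)

L : ℕ → ℕ → ℕ → ℕ
L c m n = foldr lcm 1 (map (λ k → k ℕ.* k ℕ.+ c) (range m n))

prodRange : ℕ → ℕ → (ℕ → ℕ) → ℕ
prodRange a b f = foldr ℕ._*_ 1 (map f (range a b))

-- "the integer a is a multiple of the (nonzero) rational p/q" (p, q ≠ 0):
-- a / (p/q) = a*q/p is an integer, i.e. a*q = z*p for some integer z.
IsMultipleOfFrac : ℤ → ℕ → ℕ → Set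
IsMultipleOfFrac a p q = ∃[ z ] (a ℤ.* (+ q) ≡ z ℤ.* (+ p))

⟦_⟧ : ℕ → ℚ
⟦ n ⟧ = + n / 1

-- partial sums  S_M = Σ_{j=1}^{M} 1/j²  (so π² = 6 · lim S_M)
zeta2Partial : ℕ → ℚ
zeta2Partial zero    = 0ℚ
zeta2Partial (suc j) = zeta2Partial j ℚ.+ (+ 1 / suc j) ℚ.* (+ 1 / suc j)

piSqPartial : ℕ → ℚ
piSqPartial M = ⟦ 6 ⟧ ℚ.* zeta2Partial M

expTerm : ℚ → ℕ → ℚ
expTerm x zero    = 1ℚ
expTerm x (suc k) = expTerm x k ℚ.* x ℚ.* (+ 1 / suc k)

expPartial : ℕ → ℚ → ℚ
expPartial zero    x = 0ℚ
expPartial (suc N) x = expPartial N x ℚ.+ expTerm x N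

-- rational approximations E_{N,M} of  e^{2π²c/3}; for c ≥ 0 they are
-- monotone in N and M and their supremum is exactly e^{2π²c/3}.
expTwoPiSqCOver3Approx : ℕ → ℕ → ℕ → ℚ
expTwoPiSqCOver3Approx c N M =
  expPartial N (⟦ 2 ⟧ ℚ.* piSqPartial M ℚ.* ⟦ c ⟧ ℚ.* (+ 1 / 3))

-- For rationals q and r ≥ 0:  q ≤ r · e^{2π²c/3}  (real inequality),
-- expressed through the supremum of the approximations.
LeTimesExp : ℚ → ℚ → ℕ → Set
LeTimesExp q r c =
  ∀ (ε : ℚ) → 0ℚ ℚ.< ε →
    ∃[ N ] ∃[ M ] (q ℚ.< r ℚ.* expTwoPiSqCOver3Approx c N M ℚ.+ ε)

{-# OPTIONS --safe #-}
-- For a prime p let ν be the p-adic valuation and aᵢ = (m+i)² + c, 0 ≤ i ≤ r = n − m.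
-- A common divisor of aᵢ and aᵢ₊d divides d(d² + 4c), since
-- 2x((x+d)²+c) + d(x²+c) + d(d²+4c) = d((x+d)²+c) + 4d(x²+c) + 2x(x²+c);
-- so min(ν aᵢ, ν aᵢ₊d) ≤ ν(d(d²+4c)), while ν aᵢ ≤ ν L. Counting, for each level e,
-- the indices i with ν aᵢ ≥ e (all but the first are at distinct distances d from
-- it, each with ν(d(d²+4c)) ≥ e) gives ν ∏ aᵢ ≤ ν L + Σ_d ν(d(d²+4c)), hence
-- ∏ aᵢ ∣ L · r! · ∏_{d ≤ r} (d² + 4c), which is (1).
-- For (2), m · n! = m! · ∏ (m+i) and (m+i)² ≤ aᵢ give m² n!² ≤ m!² ∏ aᵢ, and
-- ∏_{d ≤ r} (d² + 4c) = r!² ∏ (1 + 4c/d²) ≤ r!² exp(4c Σ 1/d²) ≤ r!² e^{2π²c/3}.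
module Submission where

open import Data.Nat.Base using (ℕ)
open import Data.Nat.Primality using (Prime)

module BigOperators where

  open import Data.Nat
  open import Data.Nat.Properties
  open import Data.Nat.Divisibility using (_∣_; ∣-trans)
  open import Data.Nat.GCD using (gcd)
  open import Data.Nat.LCM using (lcm; m∣lcm[m,n]; n∣lcm[m,n]; gcd*lcm)
  open import Data.Nat.ListAction using (sum; product)
  open import Data.Nat.ListAction.Properties using (product-++)
  open import Data.List using (foldr; applyUpTo; [_]; _++_)
  open import Data.List.Properties using (applyUpTo-∷ʳ)
  open import Function using (_∘_)
  open import Relation.Binary.PropositionalEquality hiding ([_])
  open import Data.Nat.Tactic.RingSolver using (solve-∀)

  sumUpTo prodUpTo lcmUpTo : (ℕ → ℕ) → ℕ → ℕ
  sumUpTo f k = sum (applyUpTo f k)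
  prodUpTo f k = product (applyUpTo f k)
  lcmUpTo f k = foldr lcm 1 (applyUpTo f k)

  sumUpTo-mono-≤ : ∀ {f g} k → (∀ i → i < k → f i ≤ g i) → sumUpTo f k ≤ sumUpTo g k
  sumUpTo-mono-≤ zero    f≤g = z≤n
  sumUpTo-mono-≤ (suc k) f≤g =
    +-mono-≤ (f≤g 0 z<s) (sumUpTo-mono-≤ k (λ i i<k → f≤g (suc i) (s<s i<k)))

  sumUpTo-+ : ∀ f g k → sumUpTo (λ i → f i + g i) k ≡ sumUpTo f k + sumUpTo g k
  sumUpTo-+ f g zero    = refl
  sumUpTo-+ f g (suc k) = begin
    (f 0 + g 0) + sumUpTo (λ i → f (suc i) + g (suc i)) k
      ≡⟨ cong ((f 0 + g 0) +_) (sumUpTo-+ (f ∘ suc) (g ∘ suc) k) ⟩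
    (f 0 + g 0) + (sumUpTo (f ∘ suc) k + sumUpTo (g ∘ suc) k)
      ≡⟨ +-+-interchange (f 0) (g 0) _ _ ⟩
    (f 0 + sumUpTo (f ∘ suc) k) + (g 0 + sumUpTo (g ∘ suc) k) ∎
    where
    open ≡-Reasoning
    +-+-interchange : ∀ a b c d → (a + b) + (c + d) ≡ (a + c) + (b + d)
    +-+-interchange = solve-∀

  sumUpTo-cong : ∀ {f g} k → (∀ i → f i ≡ g i) → sumUpTo f k ≡ sumUpTo g k
  sumUpTo-cong zero    f≡g = refl
  sumUpTo-cong (suc k) f≡g = cong₂ _+_ (f≡g 0) (sumUpTo-cong k (f≡g ∘ suc))

  sumUpTo-≤-suc : ∀ f k → sumUpTo f k ≤ sumUpTo f (suc k)
  sumUpTo-≤-suc f zero    = z≤n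
  sumUpTo-≤-suc f (suc k) = +-monoʳ-≤ (f 0) (sumUpTo-≤-suc (f ∘ suc) k)

  sumUpTo-zero : ∀ k → sumUpTo (λ _ → 0) k ≡ 0
  sumUpTo-zero zero    = refl
  sumUpTo-zero (suc k) = sumUpTo-zero k

  prodUpTo-suc : ∀ f k → prodUpTo f (suc k) ≡ prodUpTo f k * f k
  prodUpTo-suc f k = begin
    product (applyUpTo f (suc k))             ≡⟨ cong product (applyUpTo-∷ʳ f k) ⟨
    product (applyUpTo f k ++ [ f k ])        ≡⟨ product-++ (applyUpTo f k) [ f k ] ⟩
    product (applyUpTo f k) * (f k * 1)       ≡⟨ cong (product (applyUpTo f k) *_) (*-identityʳ (f k)) ⟩
    product (applyUpTo f k) * f k             ∎
    where
    open ≡-Reasoning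

  prodUpTo-* : ∀ f g k → prodUpTo (λ i → f i * g i) k ≡ prodUpTo f k * prodUpTo g k
  prodUpTo-* f g zero    = refl
  prodUpTo-* f g (suc k) =
    trans (cong (f 0 * g 0 *_) (prodUpTo-* (f ∘ suc) (g ∘ suc) k)) (*-*-interchange (f 0) (g 0) _ _)
    where
    *-*-interchange : ∀ a b c d → (a * b) * (c * d) ≡ (a * c) * (b * d)
    *-*-interchange = solve-∀

  prodUpTo-mono-≤ : ∀ {f g} k → (∀ i → f i ≤ g i) → prodUpTo f k ≤ prodUpTo g k
  prodUpTo-mono-≤ zero    f≤g = ≤-refl
  prodUpTo-mono-≤ (suc k) f≤g = *-mono-≤ (f≤g 0) (prodUpTo-mono-≤ k (f≤g ∘ suc))

  prodUpTo-nonZero : ∀ {f} k → (∀ i → NonZero (f i)) → NonZero (prodUpTo f k)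
  prodUpTo-nonZero zero    f≢0 = _
  prodUpTo-nonZero {f} (suc k) f≢0 =
    m*n≢0 (f 0) _ {{f≢0 0}} {{prodUpTo-nonZero k (f≢0 ∘ suc)}}

  lcm-nonZero : ∀ m n → .{{NonZero m}} → .{{NonZero n}} → NonZero (lcm m n)
  lcm-nonZero m n = m*n≢0⇒n≢0 (gcd m n) {{subst NonZero (sym (gcd*lcm m n)) (m*n≢0 m n)}}

  lcmUpTo-nonZero : ∀ {f} k → (∀ i → NonZero (f i)) → NonZero (lcmUpTo f k)
  lcmUpTo-nonZero zero    f≢0 = _
  lcmUpTo-nonZero {f} (suc k) f≢0 =
    lcm-nonZero (f 0) _ {{f≢0 0}} {{lcmUpTo-nonZero k (f≢0 ∘ suc)}}

  ∣lcmUpTo : ∀ f {k} i → i < k → f i ∣ lcmUpTo f k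
  ∣lcmUpTo f {suc k} zero    _   = m∣lcm[m,n] (f 0) _
  ∣lcmUpTo f {suc k} (suc i) i<k =
    ∣-trans (∣lcmUpTo (f ∘ suc) i (s<s⁻¹ i<k)) (n∣lcm[m,n] (f 0) _)

  factorial-+ : ∀ m k → (m + k) ! ≡ m ! * prodUpTo (λ i → suc (m + i)) k
  factorial-+ m zero    = trans (cong _! (+-identityʳ m)) (sym (*-identityʳ (m !)))
  factorial-+ m (suc k) = begin
    (m + suc k) !                                       ≡⟨ cong _! (+-suc m k) ⟩
    suc (m + k) * (m + k) !                             ≡⟨ cong (suc (m + k) *_) (factorial-+ m k) ⟩
    suc (m + k) * (m ! * prodUpTo (λ i → suc (m + i)) k) ≡⟨ rearrange (suc (m + k)) (m !) _ ⟩
    m ! * (prodUpTo (λ i → suc (m + i)) k * suc (m + k)) ≡⟨ cong (m ! *_) (prodUpTo-suc (λ i → suc (m + i)) k) ⟨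
    m ! * prodUpTo (λ i → suc (m + i)) (suc k)          ∎
    where
    open ≡-Reasoning
    rearrange : ∀ a b c → a * (b * c) ≡ b * (c * a)
    rearrange = solve-∀

  prodUpTo-suc≡! : ∀ k → prodUpTo suc k ≡ k !
  prodUpTo-suc≡! k = trans (sym (+-identityʳ _)) (sym (factorial-+ 0 k))


module GapSum where

  open import Data.Nat
  open import Data.Nat.Properties
  open import Function using (_∘_)
  open import Relation.Binary.PropositionalEquality
  open import Data.Nat.Tactic.RingSolver using (solve-∀)
  open BigOperators

  sgn : ℕ → ℕ
  sgn zero    = 0
  sgn (suc _) = 1

  sgn-mono-≤ : ∀ {m n} → m ≤ n → sgn m ≤ sgn n
  sgn-mono-≤ {zero}          _         = z≤n
  sgn-mono-≤ {suc _} {suc _} _         = ≤-refl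

  sgn[suc⊓n]≡sgn[n] : ∀ m n → sgn (suc m ⊓ n) ≡ sgn n
  sgn[suc⊓n]≡sgn[n] m zero    = refl
  sgn[suc⊓n]≡sgn[n] m (suc n) = refl

  n∸1+sgn[n]≡n : ∀ n → n ∸ 1 + sgn n ≡ n
  n∸1+sgn[n]≡n zero    = refl
  n∸1+sgn[n]≡n (suc n) = +-comm n 1

  sumUpTo-split : ∀ f k → sumUpTo f k ≡ sumUpTo (λ i → f i ∸ 1) k + sumUpTo (sgn ∘ f) k
  sumUpTo-split f k =
    trans (sumUpTo-cong k (λ i → sym (n∸1+sgn[n]≡n (f i)))) (sumUpTo-+ (λ i → f i ∸ 1) (sgn ∘ f) k)

  BoundedBy : ℕ → ℕ → (ℕ → ℕ) → Set
  BoundedBy M r x = ∀ i → i ≤ r → x i ≤ M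

  GapBoundedBy : (ℕ → ℕ) → ℕ → (ℕ → ℕ) → Set
  GapBoundedBy y r x = ∀ i d → i + suc d ≤ r → x i ⊓ x (i + suc d) ≤ y d

  -- If some x i is positive, take the first such i: each later positive x j
  -- makes the gap j ∸ i count in y.
  sumUpTo-sgn-≤ : ∀ M r x y → BoundedBy M r x → GapBoundedBy y r x →
                  sumUpTo (sgn ∘ x) (suc r) ≤ sgn M + sumUpTo (sgn ∘ y) r
  sumUpTo-sgn-≤ M zero    x y x≤M gap = +-monoˡ-≤ 0 (sgn-mono-≤ (x≤M 0 z≤n))
  sumUpTo-sgn-≤ M (suc r) x y x≤M gap with x 0 in x₀≡
  ... | zero   = ≤-trans
        (sumUpTo-sgn-≤ M r (x ∘ suc) y (λ i i≤r → x≤M (suc i) (s≤s i≤r))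
                                       (λ i d i+d<r → gap (suc i) d (s≤s i+d<r)))
        (+-monoʳ-≤ (sgn M) (sumUpTo-≤-suc (sgn ∘ y) r))
  ... | suc x₀ = +-mono-≤ (sgn-mono-≤ (subst (_≤ M) x₀≡ (x≤M 0 z≤n))) (sumUpTo-mono-≤ (suc r) later≤)
    where
    later≤ : ∀ i → i < suc r → sgn (x (suc i)) ≤ sgn (y i)
    later≤ i i<r = subst (_≤ sgn (y i))
      (trans (cong (λ t → sgn (t ⊓ x (suc i))) x₀≡) (sgn[suc⊓n]≡sgn[n] x₀ (x (suc i))))
      (sgn-mono-≤ (gap 0 i i<r))

  -- Layer cake: x = (x ∸ 1) + sgn x, with the counting bound on the bottom layer.
  sumUpTo-≤-bound+gaps : ∀ M r x y → BoundedBy M r x → GapBoundedBy y r x →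
                         sumUpTo x (suc r) ≤ M + sumUpTo y r
  sumUpTo-≤-bound+gaps zero    r x y x≤0 gap = begin
    sumUpTo x (suc r)            ≤⟨ sumUpTo-mono-≤ (suc r) (λ i i<r → x≤0 i (s≤s⁻¹ i<r)) ⟩
    sumUpTo (λ _ → 0) (suc r)    ≡⟨ sumUpTo-zero (suc r) ⟩
    0                            ≤⟨ z≤n ⟩
    sumUpTo y r                  ∎
    where open ≤-Reasoning
  sumUpTo-≤-bound+gaps (suc M) r x y x≤M gap = begin
    sumUpTo x (suc r)
      ≡⟨ sumUpTo-split x (suc r) ⟩
    sumUpTo (λ i → x i ∸ 1) (suc r) + sumUpTo (sgn ∘ x) (suc r)
      ≤⟨ +-mono-≤ upper-layers (sumUpTo-sgn-≤ (suc M) r x y x≤M gap) ⟩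
    (M + sumUpTo (λ i → y i ∸ 1) r) + (1 + sumUpTo (sgn ∘ y) r)
      ≡⟨ rearrange M _ _ ⟩
    suc M + (sumUpTo (λ i → y i ∸ 1) r + sumUpTo (sgn ∘ y) r)
      ≡⟨ cong (suc M +_) (sumUpTo-split y r) ⟨
    suc M + sumUpTo y r ∎
    where
    open ≤-Reasoning
    rearrange : ∀ a b c → (a + b) + (1 + c) ≡ (1 + a) + (b + c)
    rearrange = solve-∀
    upper-layers : sumUpTo (λ i → x i ∸ 1) (suc r) ≤ M + sumUpTo (λ i → y i ∸ 1) r
    upper-layers = sumUpTo-≤-bound+gaps M r (λ i → x i ∸ 1) (λ d → y d ∸ 1)
      (λ i i≤r → ∸-monoˡ-≤ 1 (x≤M i i≤r))
      (λ i d i+d≤r → subst (_≤ y d ∸ 1) (∸-distribʳ-⊓ 1 (x i) (x (i + suc d))) (∸-monoˡ-≤ 1 (gap i d i+d≤r)))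


module Valuation (p : ℕ) (p-prime : Prime p) where

  open import Data.Nat
  open import Data.Nat.Properties
  open import Data.Nat.Divisibility
  open import Data.Nat.Primality
  open import Data.Nat.Induction using (<-rec)
  open import Data.Product using (∃; _×_; _,_; proj₁; proj₂)
  open import Data.Sum using (inj₁; inj₂)
  open import Data.Empty using (⊥-elim)
  open import Relation.Nullary using (¬_; yes; no)
  open import Relation.Binary.PropositionalEquality
  open import Function using (_∘_)
  open import Data.Nat.Tactic.RingSolver using (solve-∀)
  open BigOperators

  instance
    p≢0 : NonZero p
    p≢0 = prime⇒nonZero p-prime
    p-nonTrivial : NonTrivial p
    p-nonTrivial = prime⇒nonTrivial p-prime

  IsValuation : ℕ → ℕ → Set
  IsValuation n v = p ^ v ∣ n × ¬ (p ^ suc v ∣ n)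

  ^-monoʳ-∣ : ∀ {e f} → e ≤ f → p ^ e ∣ p ^ f
  ^-monoʳ-∣ {e} {f} e≤f = divides (p ^ (f ∸ e)) (begin
    p ^ f                ≡⟨ cong (p ^_) (m+[n∸m]≡n e≤f) ⟨
    p ^ (e + (f ∸ e))    ≡⟨ ^-distribˡ-+-* p e (f ∸ e) ⟩
    p ^ e * p ^ (f ∸ e)  ≡⟨ *-comm (p ^ e) _ ⟩
    p ^ (f ∸ e) * p ^ e  ∎)
    where open ≡-Reasoning

  valuation-exists : ∀ n → NonZero n → ∃ (IsValuation n)
  valuation-exists = <-rec (λ n → NonZero n → ∃ (IsValuation n)) step
    where
    step : ∀ n → (∀ {m} → m < n → NonZero m → ∃ (IsValuation m)) → NonZero n → ∃ (IsValuation n)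
    step n rec n≢0 with p ∣? n
    ... | no p∤n = 0 , 1∣ n , p∤n ∘ subst (_∣ n) (*-identityʳ p)
    ... | yes p∣n@(divides q n≡q*p) = suc v , p^[1+v]∣n , p^[2+v]∤n
      where
      q-val = rec (quotient-< p∣n {{p-nonTrivial}} {{n≢0}}) (quotient≢0 p∣n {{n≢0}})
      v = proj₁ q-val
      p*q≡n : p * q ≡ n
      p*q≡n = trans (*-comm p q) (sym n≡q*p)
      p^[1+v]∣n : p ^ suc v ∣ n
      p^[1+v]∣n = subst (p ^ suc v ∣_) p*q≡n (*-monoʳ-∣ p (proj₁ (proj₂ q-val)))
      p^[2+v]∤n : ¬ (p ^ suc (suc v) ∣ n)
      p^[2+v]∤n d = proj₂ (proj₂ q-val) (*-cancelˡ-∣ p (subst (p ^ suc (suc v) ∣_) (sym p*q≡n) d))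

  -- ν 0 = 0 is a junk value; every lemma below assumes a nonzero argument.
  ν : ℕ → ℕ
  ν zero        = 0
  ν n@(suc _)   = proj₁ (valuation-exists n _)

  ν-isValuation : ∀ n → .{{NonZero n}} → IsValuation n (ν n)
  ν-isValuation n@(suc _) = proj₂ (valuation-exists n _)

  valuation-≥ : ∀ {n v e} → IsValuation n v → p ^ e ∣ n → e ≤ v
  valuation-≥ {v = v} {e} (_ , p^[1+v]∤n) p^e∣n with e ≤? v
  ... | yes e≤v = e≤v
  ... | no  e≰v = ⊥-elim (p^[1+v]∤n (∣-trans (^-monoʳ-∣ (≰⇒> e≰v)) p^e∣n))

  valuation-unique : ∀ {n v w} → IsValuation n v → IsValuation n w → v ≡ w
  valuation-unique n-v n-w = ≤-antisym (valuation-≥ n-w (proj₁ n-v)) (valuation-≥ n-v (proj₁ n-w))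

  p∤cofactor : ∀ {n n′ v} → IsValuation n v → n ≡ n′ * p ^ v → ¬ (p ∣ n′)
  p∤cofactor {v = v} (_ , p^[1+v]∤n) n≡n′*p^v p∣n′ =
    p^[1+v]∤n (subst (p * p ^ v ∣_) (sym n≡n′*p^v) (*-monoˡ-∣ (p ^ v) p∣n′))

  IsValuation-* : ∀ {x y v w} → IsValuation x v → IsValuation y w → IsValuation (x * y) (v + w)
  IsValuation-* {x} {y} {v} {w} x-v@(divides x′ x≡ , _) y-w@(divides y′ y≡ , _) = p^[v+w]∣xy , p^[1+v+w]∤xy
    where
    xy≡ : x * y ≡ (x′ * y′) * p ^ (v + w)
    xy≡ = trans (cong₂ _*_ x≡ y≡) (trans (interchange x′ (p ^ v) y′ (p ^ w))
                                        (cong (x′ * y′ *_) (sym (^-distribˡ-+-* p v w))))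
      where
      interchange : ∀ a b c d → (a * b) * (c * d) ≡ (a * c) * (b * d)
      interchange = solve-∀
    p^[v+w]∣xy : p ^ (v + w) ∣ x * y
    p^[v+w]∣xy = divides (x′ * y′) xy≡
    p^[1+v+w]∤xy : ¬ (p ^ suc (v + w) ∣ x * y)
    p^[1+v+w]∤xy d with euclidsLemma x′ y′ p-prime
                          (*-cancelʳ-∣ (p ^ (v + w)) {{m^n≢0 p (v + w)}} (subst (p ^ suc (v + w) ∣_) xy≡ d))
    ... | inj₁ p∣x′ = p∤cofactor {v = v} x-v x≡ p∣x′
    ... | inj₂ p∣y′ = p∤cofactor {v = w} y-w y≡ p∣y′

  ν-* : ∀ x y → .{{NonZero x}} → .{{NonZero y}} → ν (x * y) ≡ ν x + ν y
  ν-* x y = valuation-unique (ν-isValuation (x * y) {{m*n≢0 x y}})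
                             (IsValuation-* {v = ν x} {w = ν y} (ν-isValuation x) (ν-isValuation y))

  ν[1]≡0 : ν 1 ≡ 0
  ν[1]≡0 = valuation-unique (ν-isValuation 1)
    (1∣ 1 , λ p^1∣1 → <⇒≢ (nonTrivial⇒n>1 p) (sym (trans (sym (*-identityʳ p)) (∣1⇒≡1 p^1∣1))))

  ν-prodUpTo : ∀ {f} k → (∀ i → NonZero (f i)) → ν (prodUpTo f k) ≡ sumUpTo (ν ∘ f) k
  ν-prodUpTo zero    f≢0 = ν[1]≡0
  ν-prodUpTo {f} (suc k) f≢0 =
    trans (ν-* (f 0) _ {{f≢0 0}} {{prodUpTo-nonZero k (f≢0 ∘ suc)}})
          (cong (ν (f 0) +_) (ν-prodUpTo k (f≢0 ∘ suc)))

  ^∣⇒≤ν : ∀ n {e} → .{{NonZero n}} → p ^ e ∣ n → e ≤ ν n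
  ^∣⇒≤ν n = valuation-≥ (ν-isValuation n)

  ≤ν⇒^∣ : ∀ n {e} → .{{NonZero n}} → e ≤ ν n → p ^ e ∣ n
  ≤ν⇒^∣ n e≤ν = ∣-trans (^-monoʳ-∣ e≤ν) (proj₁ (ν-isValuation n))

  ν-mono-∣ : ∀ m n → .{{NonZero m}} → .{{NonZero n}} → m ∣ n → ν m ≤ ν n
  ν-mono-∣ m n m∣n = ^∣⇒≤ν n (∣-trans (proj₁ (ν-isValuation m)) m∣n)


module PrimePowers where

  open import Data.Nat
  open import Data.Nat.Properties
  open import Data.Nat.Divisibility
  open import Data.Nat.Primality
  open import Data.Nat.Primality.Factorisation using (factorise; PrimeFactorisation)
  open import Data.Nat.Coprimality using (Coprime; coprime-divisor)
  open import Data.Nat.ListAction using (product)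
  open import Data.List using ([]; _∷_)
  open import Data.List.Relation.Unary.All using (All; []; _∷_)
  open import Data.Sum using (inj₁; inj₂)
  open import Data.Product using (_,_)
  open import Data.Empty using (⊥-elim)
  open import Relation.Nullary using (yes; no)
  open import Relation.Binary.PropositionalEquality

  prime∣^⇒∣ : ∀ {p q} e → Prime p → p ∣ q ^ e → p ∣ q
  prime∣^⇒∣ zero    p-prime p∣1 = ⊥-elim (¬prime[1] (subst Prime (∣1⇒≡1 p∣1) p-prime))
  prime∣^⇒∣ {q = q} (suc e) p-prime p∣q^[1+e] with euclidsLemma q (q ^ e) p-prime p∣q^[1+e]
  ... | inj₁ p∣q   = p∣q
  ... | inj₂ p∣q^e = prime∣^⇒∣ e p-prime p∣q^e

  ^-coprime-prime : ∀ {p q} e → Prime p → Prime q → q ≢ p → Coprime (q ^ e) p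
  ^-coprime-prime e p-prime q-prime q≢p (d∣q^e , d∣p) with prime⇒irreducible p-prime d∣p
  ... | inj₁ d≡1 = d≡1
  ... | inj₂ refl with prime⇒irreducible q-prime (prime∣^⇒∣ e p-prime d∣q^e)
  ...   | inj₁ p≡1 = ⊥-elim (¬prime[1] (subst Prime p≡1 p-prime))
  ...   | inj₂ p≡q = ⊥-elim (q≢p (sym p≡q))

  DividesPrimePowersOf : ℕ → ℕ → Set
  DividesPrimePowersOf a b = ∀ q e → Prime q → q ^ e ∣ a → q ^ e ∣ b

  -- Peel off one prime p of the factorisation: p ∣ b, and b / p still
  -- receives every prime power dividing the remaining product.
  product∣ : ∀ {b} ps → All Prime ps → DividesPrimePowersOf (product ps) b → product ps ∣ b
  product∣ []       []                 _  = 1∣ _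
  product∣ {b} (p ∷ ps) (p-prime ∷ ps-prime) pp
    with pp p 1 p-prime (subst (_∣ p * product ps) (sym (*-identityʳ p)) (m∣m*n (product ps)))
  ... | divides b′ b≡ = subst (p * product ps ∣_) (sym b≡p*b′) (*-monoʳ-∣ p (product∣ ps ps-prime pp′))
    where
    instance
      p≢0 : NonZero p
      p≢0 = prime⇒nonZero p-prime
    b≡p*b′ : b ≡ p * b′
    b≡p*b′ = trans b≡ (trans (cong (b′ *_) (*-identityʳ p)) (*-comm b′ p))
    pp′ : DividesPrimePowersOf (product ps) b′
    pp′ q e q-prime q^e∣ps with q ≟ p
    ... | yes refl = *-cancelˡ-∣ p (subst (p * q ^ e ∣_) b≡p*b′ (pp p (suc e) p-prime (*-monoʳ-∣ p q^e∣ps)))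
    ... | no  q≢p  = coprime-divisor (^-coprime-prime e p-prime q-prime q≢p)
                       (subst (q ^ e ∣_) b≡p*b′ (pp q e q-prime (∣-trans q^e∣ps (n∣m*n p))))

  ∣-by-prime-powers : ∀ a {b} → .{{NonZero a}} → DividesPrimePowersOf a b → a ∣ b
  ∣-by-prime-powers a pp = subst (_∣ _) (sym a≡)
    (product∣ factors factorsPrime (λ q e q-prime d → pp q e q-prime (subst (q ^ e ∣_) (sym a≡) d)))
    where
    F = factorise a
    open PrimeFactorisation F using (factors; factorsPrime) renaming (isFactorisation to a≡)

  ∣-by-valuations : ∀ a b → .{{NonZero a}} → .{{NonZero b}} →
                    (∀ q (q-prime : Prime q) → Valuation.ν q q-prime a ≤ Valuation.ν q q-prime b) → a ∣ b
  ∣-by-valuations a b ν≤ν = ∣-by-prime-powers a λ q e q-prime q^e∣a →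
    let open Valuation q q-prime in ≤ν⇒^∣ b {e} (≤-trans (^∣⇒≤ν a {e} q^e∣a) (ν≤ν q q-prime))


module LcmProduct where

  open import Data.Nat
  open import Data.Nat.Properties
  open import Data.Nat.Divisibility
  open import Function using (_∘_)
  open import Relation.Binary.PropositionalEquality
  open import Data.Nat.Tactic.RingSolver using (solve-∀)
  open BigOperators
  open GapSum
  open PrimePowers

  -- Prime by prime, the valuations of f satisfy the hypotheses of the gap-sum bound.
  prodUpTo∣lcmUpTo*prodUpTo : ∀ f h r → (∀ i → NonZero (f i)) → (∀ d → NonZero (h d)) →
    (∀ t i d → t ∣ f i → t ∣ f (i + suc d) → t ∣ h d) →
    prodUpTo f (suc r) ∣ lcmUpTo f (suc r) * prodUpTo h r
  prodUpTo∣lcmUpTo*prodUpTo f h r f≢0 h≢0 common∣h =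
    ∣-by-valuations (prodUpTo f (suc r)) (ℓ * prodUpTo h r) ν-bound
    where
    ℓ = lcmUpTo f (suc r)
    instance
      ∏f≢0 : NonZero (prodUpTo f (suc r))
      ∏f≢0 = prodUpTo-nonZero (suc r) f≢0
      ∏h≢0 : NonZero (prodUpTo h r)
      ∏h≢0 = prodUpTo-nonZero r h≢0
      ℓ≢0 : NonZero ℓ
      ℓ≢0 = lcmUpTo-nonZero (suc r) f≢0
      ℓ*∏h≢0 : NonZero (ℓ * prodUpTo h r)
      ℓ*∏h≢0 = m*n≢0 ℓ (prodUpTo h r)
    ν-bound : ∀ q q-prime → Valuation.ν q q-prime (prodUpTo f (suc r))
                          ≤ Valuation.ν q q-prime (ℓ * prodUpTo h r)
    ν-bound q q-prime = begin
      ν (prodUpTo f (suc r))           ≡⟨ ν-prodUpTo (suc r) f≢0 ⟩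
      sumUpTo (ν ∘ f) (suc r)          ≤⟨ sumUpTo-≤-bound+gaps (ν ℓ) r (ν ∘ f) (ν ∘ h) bounded gapBounded ⟩
      ν ℓ + sumUpTo (ν ∘ h) r          ≡⟨ cong (ν ℓ +_) (ν-prodUpTo r h≢0) ⟨
      ν ℓ + ν (prodUpTo h r)           ≡⟨ ν-* ℓ (prodUpTo h r) ⟨
      ν (ℓ * prodUpTo h r)             ∎
      where
      open Valuation q q-prime
      open ≤-Reasoning
      bounded : BoundedBy (ν ℓ) r (ν ∘ f)
      bounded i i≤r = ν-mono-∣ (f i) ℓ {{f≢0 i}} (∣lcmUpTo f i (s≤s i≤r))
      gapBounded : GapBoundedBy (ν ∘ h) r (ν ∘ f)
      gapBounded i d _ = ^∣⇒≤ν (h d) {{h≢0 d}} (common∣h (q ^ t) i d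
        (≤ν⇒^∣ (f i) {{f≢0 i}} (m⊓n≤m (ν (f i)) (ν (f (i + suc d)))))
        (≤ν⇒^∣ (f (i + suc d)) {{f≢0 _}} (m⊓n≤n (ν (f i)) (ν (f (i + suc d))))))
        where t = ν (f i) ⊓ ν (f (i + suc d))

  ∣-shifted-squares : ∀ c x D {t} → t ∣ x * x + c → t ∣ (x + D) * (x + D) + c → t ∣ D * (D * D + 4 * c)
  ∣-shifted-squares c x D {t} t∣a t∣b =
    ∣m+n∣m⇒∣n t∣sum (∣m∣n⇒∣m+n (∣n⇒∣m*n (2 * x) t∣b) (∣n⇒∣m*n D t∣a))
    where
    a = x * x + c
    b = (x + D) * (x + D) + c
    identity : ∀ c x D →
      (2 * x * ((x + D) * (x + D) + c) + D * (x * x + c)) + D * (D * D + 4 * c)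
      ≡ D * ((x + D) * (x + D) + c) + 4 * D * (x * x + c) + 2 * x * (x * x + c)
    identity = solve-∀
    t∣sum : t ∣ (2 * x * b + D * a) + D * (D * D + 4 * c)
    t∣sum = subst (t ∣_) (sym (identity c x D))
      (∣m∣n⇒∣m+n (∣m∣n⇒∣m+n (∣n⇒∣m*n D t∣b) (∣n⇒∣m*n (4 * D) t∣a)) (∣n⇒∣m*n (2 * x) t∣a))


module ShiftedSquares (c m : ℕ) where

  open import Data.Nat
  open import Data.Nat.Properties
  open import Data.Nat.Divisibility using (_∣_; ∣⇒≤)
  open import Relation.Binary.PropositionalEquality
  open import Data.Nat.Tactic.RingSolver using (solve-∀)
  open BigOperators
  open LcmProduct

  a q : ℕ → ℕ
  a i = (m + i) * (m + i) + c
  q i = suc i * suc i + 4 * c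

  module _ (1≤c : 1 ≤ c) where

    a≢0 : ∀ i → NonZero (a i)
    a≢0 i = >-nonZero (≤-trans 1≤c (m≤n+m c _))

    ∏a∣lcm*r!*∏q : ∀ r → prodUpTo a (suc r) ∣ lcmUpTo a (suc r) * (r ! * prodUpTo q r)
    ∏a∣lcm*r!*∏q r = subst (λ t → prodUpTo a (suc r) ∣ lcmUpTo a (suc r) * t) ∏h≡r!*∏q
      (prodUpTo∣lcmUpTo*prodUpTo a h r a≢0 (λ d → m*n≢0 (suc d) _) common∣h)
      where
      h : ℕ → ℕ
      h d = suc d * q d
      common∣h : ∀ t i d → t ∣ a i → t ∣ a (i + suc d) → t ∣ h d
      common∣h t i d t∣aᵢ t∣aⱼ = ∣-shifted-squares c (m + i) (suc d) t∣aᵢ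
        (subst (λ x → t ∣ x * x + c) (sym (+-assoc m i (suc d))) t∣aⱼ)
      ∏h≡r!*∏q : prodUpTo h r ≡ r ! * prodUpTo q r
      ∏h≡r!*∏q = trans (prodUpTo-* suc q r) (cong (_* prodUpTo q r) (prodUpTo-suc≡! r))

    m²[m+r]!²≤c*lcm*m!²*r!*∏q : ∀ r →
      m * m * ((m + r) ! * (m + r) !) ≤ c * lcmUpTo a (suc r) * (m ! * m ! * r !) * prodUpTo q r
    m²[m+r]!²≤c*lcm*m!²*r!*∏q r = begin
      m * m * ((m + r) ! * (m + r) !)     ≡⟨ cong (λ t → m * m * (t * t)) (factorial-+ m r) ⟩
      m * m * ((m ! * K) * (m ! * K))     ≡⟨ regroup m (m !) K ⟩
      m ! * m ! * (m * m * (K * K))       ≤⟨ *-monoʳ-≤ (m ! * m !) square≤∏a ⟩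
      m ! * m ! * prodUpTo a (suc r)      ≤⟨ *-monoʳ-≤ (m ! * m !) (∣⇒≤ {{ℓ*r!*∏q≢0}} (∏a∣lcm*r!*∏q r)) ⟩
      m ! * m ! * (ℓ * (r ! * ∏q))        ≤⟨ m≤n*m _ c {{>-nonZero 1≤c}} ⟩
      c * (m ! * m ! * (ℓ * (r ! * ∏q)))  ≡⟨ regroup′ c (m !) ℓ (r !) ∏q ⟩
      c * ℓ * (m ! * m ! * r !) * ∏q      ∎
      where
      open ≤-Reasoning
      K = prodUpTo (λ i → suc (m + i)) r
      ℓ = lcmUpTo a (suc r)
      ∏q = prodUpTo q r
      ℓ*r!*∏q≢0 : NonZero (ℓ * (r ! * ∏q))
      ℓ*r!*∏q≢0 = m*n≢0 ℓ _ {{lcmUpTo-nonZero (suc r) a≢0}}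
                           {{m*n≢0 (r !) ∏q {{r !≢0}} {{prodUpTo-nonZero r (λ _ → _)}}}}
      regroup : ∀ m f k → m * m * ((f * k) * (f * k)) ≡ f * f * (m * m * (k * k))
      regroup = solve-∀
      regroup′ : ∀ c f l t q → c * (f * f * (l * (t * q))) ≡ c * l * (f * f * t) * q
      regroup′ = solve-∀
      x*x≤y*y+c : ∀ {x y} → x ≡ y → x * x ≤ y * y + c
      x*x≤y*y+c refl = m≤m+n _ c
      square≤∏a : m * m * (K * K) ≤ prodUpTo a (suc r)
      square≤∏a = begin
        m * m * (K * K)                                        ≡⟨ cong (m * m *_) (prodUpTo-* _ _ r) ⟨
        m * m * prodUpTo (λ i → suc (m + i) * suc (m + i)) r   ≤⟨ *-mono-≤ (x*x≤y*y+c (sym (+-identityʳ m)))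
                                                                    (prodUpTo-mono-≤ r (λ i → x*x≤y*y+c (sym (+-suc m i)))) ⟩
        prodUpTo a (suc r)                                     ∎


module RationalEmbedding where

  open import Data.Nat as ℕ using (ℕ; suc)
  open import Data.Nat.Divisibility using (∣1⇒≡1)
  open import Data.Nat.Coprimality using (Coprime)
  open import Data.Integer as ℤ using (+_)
  import Data.Integer.Properties as ℤ
  open import Data.Product using (_,_)
  open import Data.Rational
  open import Data.Rational.Properties
  open import Level using (0ℓ)
  open import Relation.Nullary.Decidable using (dec⇒maybe)
  open import Relation.Binary.PropositionalEquality
  import Tactic.RingSolver.Core.AlmostCommutativeRing as ACR
  open import Defs using (⟦_⟧)

  -- The zero test lets the solver cancel constant coefficients such as 1ℚ - 1ℚ.
  ℚ-ring : ACR.AlmostCommutativeRing 0ℓ 0ℓ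
  ℚ-ring = ACR.fromCommutativeRing +-*-commutativeRing (λ q → dec⇒maybe (0ℚ ≟ q))

  coprime[n,1] : ∀ n → Coprime n 1
  coprime[n,1] n (_ , d∣1) = ∣1⇒≡1 d∣1

  ⟦n⟧≡mkℚ : ∀ n → ⟦ n ⟧ ≡ mkℚ (+ n) 0 (coprime[n,1] n)
  ⟦n⟧≡mkℚ n = normalize-coprime (coprime[n,1] n)

  ⟦+⟧ : ∀ m n → ⟦ m ℕ.+ n ⟧ ≡ ⟦ m ⟧ + ⟦ n ⟧
  ⟦+⟧ m n rewrite ⟦n⟧≡mkℚ m | ⟦n⟧≡mkℚ n =
    sym (cong₂ (λ x y → (x ℤ.+ y) / 1) (ℤ.*-identityʳ (+ m)) (ℤ.*-identityʳ (+ n)))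

  ⟦*⟧ : ∀ m n → ⟦ m ℕ.* n ⟧ ≡ ⟦ m ⟧ * ⟦ n ⟧
  ⟦*⟧ m n rewrite ⟦n⟧≡mkℚ m | ⟦n⟧≡mkℚ n = cong (_/ 1) (ℤ.pos-* m n)

  ⟦⟧-mono-≤ : ∀ {m n} → m ℕ.≤ n → ⟦ m ⟧ ≤ ⟦ n ⟧
  ⟦⟧-mono-≤ {m} {n} m≤n rewrite ⟦n⟧≡mkℚ m | ⟦n⟧≡mkℚ n =
    *≤* (subst₂ ℤ._≤_ (sym (ℤ.*-identityʳ (+ m))) (sym (ℤ.*-identityʳ (+ n))) (ℤ.+≤+ m≤n))

  ⟦⟧-nonNeg : ∀ n → 0ℚ ≤ ⟦ n ⟧
  ⟦⟧-nonNeg n = ⟦⟧-mono-≤ {0} {n} ℕ.z≤n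

  ⟦1+n⟧*1/[1+n]≡1 : ∀ n → ⟦ suc n ⟧ * (+ 1 / suc n) ≡ 1ℚ
  ⟦1+n⟧*1/[1+n]≡1 n rewrite ⟦n⟧≡mkℚ (suc n) | normalize-coprime {1} {n} (λ (d∣1 , _) → ∣1⇒≡1 d∣1) =
    *-inverseʳ (mkℚ (+ suc n) 0 (coprime[n,1] (suc n)))

  1/[1+n]-nonNeg : ∀ n → 0ℚ ≤ + 1 / suc n
  1/[1+n]-nonNeg n = nonNegative⁻¹ _ {{normalize-nonNeg 1 (suc n)}}

  nonNeg-* : ∀ {p q} → 0ℚ ≤ p → 0ℚ ≤ q → 0ℚ ≤ p * q
  nonNeg-* {p} {q} 0≤p 0≤q =
    nonNegative⁻¹ _ {{nonNeg*nonNeg⇒nonNeg p {{nonNegative 0≤p}} q {{nonNegative 0≤q}}}}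

  nonNeg-+ : ∀ {p q} → 0ℚ ≤ p → 0ℚ ≤ q → 0ℚ ≤ p + q
  nonNeg-+ {p} {q} 0≤p 0≤q =
    nonNegative⁻¹ _ {{nonNeg+nonNeg⇒nonNeg p {{nonNegative 0≤p}} q {{nonNegative 0≤q}}}}

  p≤p+q : ∀ p {q} → 0ℚ ≤ q → p ≤ p + q
  p≤p+q p 0≤q = ≤-trans (≤-reflexive (sym (+-identityʳ p))) (+-monoʳ-≤ p 0≤q)


  ⟦⟧-≤-* : ∀ X S {A Q E} → A ℕ.≤ X ℕ.* Q → ⟦ Q ⟧ ≤ ⟦ S ⟧ * E → ⟦ A ⟧ ≤ ⟦ X ℕ.* S ⟧ * E
  ⟦⟧-≤-* X S {A} {Q} {E} A≤XQ Q≤SE = begin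
    ⟦ A ⟧               ≤⟨ ⟦⟧-mono-≤ A≤XQ ⟩
    ⟦ X ℕ.* Q ⟧         ≡⟨ ⟦*⟧ X Q ⟩
    ⟦ X ⟧ * ⟦ Q ⟧       ≤⟨ *-monoˡ-≤-nonNeg ⟦ X ⟧ {{nonNegative (⟦⟧-nonNeg X)}} Q≤SE ⟩
    ⟦ X ⟧ * (⟦ S ⟧ * E) ≡⟨ *-assoc ⟦ X ⟧ ⟦ S ⟧ E ⟨
    ⟦ X ⟧ * ⟦ S ⟧ * E   ≡⟨ cong (_* E) (⟦*⟧ X S) ⟨
    ⟦ X ℕ.* S ⟧ * E     ∎
    where open ≤-Reasoning

module ExponentialBound where

  open import Data.Nat as ℕ using (ℕ; zero; suc)
  open import Data.Integer using (+_)
  open import Data.Rational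
  open import Data.Rational.Properties
  open import Relation.Binary.PropositionalEquality
  open import Defs using (⟦_⟧; expTerm; expPartial)
  open RationalEmbedding
  open import Tactic.RingSolver using (solve-∀)

  expTerm-nonNeg : ∀ {x} → 0ℚ ≤ x → ∀ k → 0ℚ ≤ expTerm x k
  expTerm-nonNeg 0≤x zero    = ⟦⟧-nonNeg 1
  expTerm-nonNeg 0≤x (suc k) = nonNeg-* (nonNeg-* (expTerm-nonNeg 0≤x k) 0≤x) (1/[1+n]-nonNeg k)

  expTerm-suc*⟦1+k⟧ : ∀ x k → expTerm x (suc k) * ⟦ suc k ⟧ ≡ expTerm x k * x
  expTerm-suc*⟦1+k⟧ x k = begin
    expTerm x k * x * u * ⟦ suc k ⟧    ≡⟨ reassoc (expTerm x k * x) u ⟦ suc k ⟧ ⟩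
    expTerm x k * x * (⟦ suc k ⟧ * u)  ≡⟨ cong (expTerm x k * x *_) (⟦1+n⟧*1/[1+n]≡1 k) ⟩
    expTerm x k * x * 1ℚ               ≡⟨ *-identityʳ _ ⟩
    expTerm x k * x                    ∎
    where
    open ≡-Reasoning
    u = + 1 / suc k
    reassoc : ∀ a u w → a * u * w ≡ a * (w * u)
    reassoc = solve-∀ ℚ-ring

  -- With A = Tₙ(p), B = Tₙ₊₁(p) = A·p/(n+1) and u = 1/(n+2): the binomial
  -- cross term x·A·p·u equals x·B·(n+1)·u, which together with x·B·u gives x·B.
  shift-identity : ∀ x A B p w u → A * p ≡ B * w → (1ℚ + w) * u ≡ 1ℚ →
    (x * A + B) * ((p + x) * u) ≡ x * B + B * p * u + x * x * A * u
  shift-identity x A B p w u A*p≡B*w [1+w]*u≡1 = begin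
    (x * A + B) * ((p + x) * u)                          ≡⟨ expand x A B p u ⟩
    x * (A * p) * u + x * B * u + B * p * u + x * x * A * u
      ≡⟨ cong (λ t → x * t * u + x * B * u + B * p * u + x * x * A * u) A*p≡B*w ⟩
    x * (B * w) * u + x * B * u + B * p * u + x * x * A * u ≡⟨ collect x A B p w u ⟩
    x * B * ((1ℚ + w) * u) + B * p * u + x * x * A * u
      ≡⟨ cong (λ t → x * B * t + B * p * u + x * x * A * u) [1+w]*u≡1 ⟩
    x * B * 1ℚ + B * p * u + x * x * A * u                ≡⟨ drop-one x A B p u ⟩
    x * B + B * p * u + x * x * A * u                     ∎
    where
    open ≡-Reasoning
    expand : ∀ x A B p u →
      (x * A + B) * ((p + x) * u) ≡ x * (A * p) * u + x * B * u + B * p * u + x * x * A * u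
    expand = solve-∀ ℚ-ring
    collect : ∀ x A B p w u →
      x * (B * w) * u + x * B * u + B * p * u + x * x * A * u ≡ x * B * ((1ℚ + w) * u) + B * p * u + x * x * A * u
    collect = solve-∀ ℚ-ring
    drop-one : ∀ x A B p u → x * B * 1ℚ + B * p * u + x * x * A * u ≡ x * B + B * p * u + x * x * A * u
    drop-one = solve-∀ ℚ-ring

  expTerm-shift-≤ : ∀ {p x} → 0ℚ ≤ p → 0ℚ ≤ x → ∀ N →
                    x * expTerm p N + expTerm p (suc N) ≤ expTerm (p + x) (suc N)
  expTerm-shift-≤ {p} {x} 0≤p 0≤x zero = ≤-reflexive (base x p)
    where
    base : ∀ x p → x * 1ℚ + 1ℚ * p * 1ℚ ≡ 1ℚ * (p + x) * 1ℚ
    base = solve-∀ ℚ-ring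
  expTerm-shift-≤ {p} {x} 0≤p 0≤x (suc N) = begin
    x * B + B * p * u
      ≤⟨ p≤p+q _ (nonNeg-* (nonNeg-* (nonNeg-* 0≤x 0≤x) (expTerm-nonNeg 0≤p N)) 0≤u) ⟩
    x * B + B * p * u + x * x * A * u
      ≡⟨ shift-identity x A B p ⟦ suc N ⟧ u (sym (expTerm-suc*⟦1+k⟧ p N)) [1+w]*u≡1 ⟨
    (x * A + B) * ((p + x) * u)
      ≤⟨ *-monoʳ-≤-nonNeg ((p + x) * u) {{nonNegative 0≤[p+x]*u}} (expTerm-shift-≤ 0≤p 0≤x N) ⟩
    expTerm (p + x) (suc N) * ((p + x) * u)
      ≡⟨ *-assoc (expTerm (p + x) (suc N)) (p + x) u ⟨
    expTerm (p + x) (suc N) * (p + x) * u ∎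
    where
    open ≤-Reasoning
    A = expTerm p N
    B = expTerm p (suc N)
    u = + 1 / suc (suc N)
    0≤u = 1/[1+n]-nonNeg (suc N)
    0≤[p+x]*u = nonNeg-* (nonNeg-+ 0≤p 0≤x) 0≤u
    [1+w]*u≡1 : (1ℚ + ⟦ suc N ⟧) * u ≡ 1ℚ
    [1+w]*u≡1 = trans (cong (_* u) (sym (⟦+⟧ 1 (suc N)))) (⟦1+n⟧*1/[1+n]≡1 (suc N))

  expPartial-shift-≤ : ∀ {p x} → 0ℚ ≤ p → 0ℚ ≤ x → ∀ N →
                       expPartial N p * (1ℚ + x) + expTerm p N ≤ expPartial (suc N) (p + x)
  expPartial-shift-≤ {p} {x} 0≤p 0≤x zero = ≤-reflexive (base x)
    where
    base : ∀ x → 0ℚ * (1ℚ + x) + 1ℚ ≡ 0ℚ + 1ℚ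
    base = solve-∀ ℚ-ring
  expPartial-shift-≤ {p} {x} 0≤p 0≤x (suc N) = begin
    (E + T) * (1ℚ + x) + T′           ≡⟨ regroup E T x T′ ⟩
    (E * (1ℚ + x) + T) + (x * T + T′) ≤⟨ +-mono-≤ (expPartial-shift-≤ 0≤p 0≤x N) (expTerm-shift-≤ 0≤p 0≤x N) ⟩
    expPartial (suc (suc N)) (p + x)  ∎
    where
    open ≤-Reasoning
    E = expPartial N p
    T = expTerm p N
    T′ = expTerm p (suc N)
    regroup : ∀ E T x T′ → (E + T) * (1ℚ + x) + T′ ≡ (E * (1ℚ + x) + T) + (x * T + T′)
    regroup = solve-∀ ℚ-ring

  ∏ℚ ∑ℚ : (ℕ → ℚ) → ℕ → ℚ
  ∏ℚ f zero    = 1ℚ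
  ∏ℚ f (suc r) = ∏ℚ f r * f r
  ∑ℚ f zero    = 0ℚ
  ∑ℚ f (suc r) = ∑ℚ f r + f r

  ∑ℚ-nonNeg : ∀ {y} → (∀ i → 0ℚ ≤ y i) → ∀ r → 0ℚ ≤ ∑ℚ y r
  ∑ℚ-nonNeg 0≤y zero    = ≤-refl
  ∑ℚ-nonNeg 0≤y (suc r) = nonNeg-+ (∑ℚ-nonNeg 0≤y r) (0≤y r)

  ∏[1+y]≤expPartial[∑y] : ∀ {y} → (∀ i → 0ℚ ≤ y i) → ∀ r →
                           ∏ℚ (λ i → 1ℚ + y i) r ≤ expPartial (suc r) (∑ℚ y r)
  ∏[1+y]≤expPartial[∑y] 0≤y zero    = ≤-refl
  ∏[1+y]≤expPartial[∑y] {y} 0≤y (suc r) = begin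
    ∏ℚ (λ i → 1ℚ + y i) r * (1ℚ + y r)
      ≤⟨ *-monoʳ-≤-nonNeg (1ℚ + y r) {{nonNegative (nonNeg-+ (⟦⟧-nonNeg 1) (0≤y r))}} (∏[1+y]≤expPartial[∑y] 0≤y r) ⟩
    expPartial (suc r) S * (1ℚ + y r)
      ≤⟨ p≤p+q _ (expTerm-nonNeg 0≤S (suc r)) ⟩
    expPartial (suc r) S * (1ℚ + y r) + expTerm S (suc r)
      ≤⟨ expPartial-shift-≤ 0≤S (0≤y r) (suc r) ⟩
    expPartial (suc (suc r)) (S + y r) ∎
    where
    open ≤-Reasoning
    S = ∑ℚ y r
    0≤S = ∑ℚ-nonNeg 0≤y r


module SquaresExponentialBound where

  open import Data.Nat as ℕ using (ℕ; zero; suc; _!)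
  open import Data.Integer using (+_)
  open import Data.Rational
  open import Data.Rational.Properties
  open import Data.Product using (_,_)
  open import Relation.Binary.PropositionalEquality
  open import Defs
  open BigOperators using (prodUpTo; prodUpTo-suc; prodUpTo-*; prodUpTo-suc≡!)
  open RationalEmbedding
  open import Tactic.RingSolver using (solve-∀)
  open ExponentialBound

  ⟦prodUpTo⟧ : ∀ f r → ⟦ prodUpTo f r ⟧ ≡ ∏ℚ (λ i → ⟦ f i ⟧) r
  ⟦prodUpTo⟧ f zero    = refl
  ⟦prodUpTo⟧ f (suc r) =
    trans (cong ⟦_⟧ (prodUpTo-suc f r)) (trans (⟦*⟧ (prodUpTo f r) (f r)) (cong (_* ⟦ f r ⟧) (⟦prodUpTo⟧ f r)))

  ∏ℚ-cong : ∀ {f g} r → (∀ i → f i ≡ g i) → ∏ℚ f r ≡ ∏ℚ g r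
  ∏ℚ-cong zero    f≡g = refl
  ∏ℚ-cong (suc r) f≡g = cong₂ _*_ (∏ℚ-cong r f≡g) (f≡g r)

  ∏ℚ-* : ∀ f g r → ∏ℚ (λ i → f i * g i) r ≡ ∏ℚ f r * ∏ℚ g r
  ∏ℚ-* f g zero    = refl
  ∏ℚ-* f g (suc r) = trans (cong (_* (f r * g r)) (∏ℚ-* f g r)) (interchange (∏ℚ f r) (∏ℚ g r) (f r) (g r))
    where
    interchange : ∀ a b c d → (a * b) * (c * d) ≡ (a * c) * (b * d)
    interchange = solve-∀ ℚ-ring

  module _ (c : ℕ) where

    y : ℕ → ℚ
    y i = ⟦ 4 ℕ.* c ⟧ * ((+ 1 / suc i) * (+ 1 / suc i))

    ⟦[1+i]²+4c⟧≡⟦[1+i]²⟧*[1+y] : ∀ i → ⟦ suc i ℕ.* suc i ℕ.+ 4 ℕ.* c ⟧ ≡ ⟦ suc i ℕ.* suc i ⟧ * (1ℚ + y i)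
    ⟦[1+i]²+4c⟧≡⟦[1+i]²⟧*[1+y] i = begin
      ⟦ suc i ℕ.* suc i ℕ.+ 4 ℕ.* c ⟧     ≡⟨ ⟦+⟧ (suc i ℕ.* suc i) (4 ℕ.* c) ⟩
      ⟦ suc i ℕ.* suc i ⟧ + F             ≡⟨ cong₂ _+_ (⟦*⟧ (suc i) (suc i)) F≡F*[wu]² ⟩
      w * w + F * ((w * u) * (w * u))     ≡⟨ factor w F u ⟩
      w * w * (1ℚ + F * (u * u))          ≡⟨ cong (_* (1ℚ + y i)) (⟦*⟧ (suc i) (suc i)) ⟨
      ⟦ suc i ℕ.* suc i ⟧ * (1ℚ + y i)    ∎
      where
      open ≡-Reasoning
      F = ⟦ 4 ℕ.* c ⟧
      w = ⟦ suc i ⟧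
      u = + 1 / suc i
      F≡F*[wu]² : F ≡ F * ((w * u) * (w * u))
      F≡F*[wu]² = sym (trans (cong (λ t → F * (t * t)) (⟦1+n⟧*1/[1+n]≡1 i)) (*-identityʳ F))
      factor : ∀ w F u → w * w + F * ((w * u) * (w * u)) ≡ w * w * (1ℚ + F * (u * u))
      factor = solve-∀ ℚ-ring

    ∑y≡approxArgument : ∀ r → ∑ℚ y r ≡ ⟦ 2 ⟧ * piSqPartial r * ⟦ c ⟧ * (+ 1 / 3)
    ∑y≡approxArgument r =
      trans (∑y≡F*ζ r) (trans (cong (_* zeta2Partial r) (⟦*⟧ 4 c)) (rearrange ⟦ c ⟧ (zeta2Partial r)))
      where
      ∑y≡F*ζ : ∀ r → ∑ℚ y r ≡ ⟦ 4 ℕ.* c ⟧ * zeta2Partial r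
      ∑y≡F*ζ zero    = sym (*-zeroʳ ⟦ 4 ℕ.* c ⟧)
      ∑y≡F*ζ (suc r) = trans (cong (_+ y r) (∑y≡F*ζ r)) (sym (*-distribˡ-+ ⟦ 4 ℕ.* c ⟧ (zeta2Partial r) _))
      rearrange′ : ∀ a b t C Z → ((a * b * t) * C) * Z ≡ a * (b * Z) * C * t
      rearrange′ = solve-∀ ℚ-ring
      -- ⟦ 2 ⟧ * ⟦ 6 ⟧ * (+ 1 / 3) reduces to ⟦ 4 ⟧
      rearrange : ∀ C Z → (⟦ 4 ⟧ * C) * Z ≡ ⟦ 2 ⟧ * (⟦ 6 ⟧ * Z) * C * (+ 1 / 3)
      rearrange = rearrange′ ⟦ 2 ⟧ ⟦ 6 ⟧ (+ 1 / 3)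

    ⟦∏[k²+4c]⟧≤[r!]²*approx : ∀ r →
      ⟦ prodUpTo (λ i → suc i ℕ.* suc i ℕ.+ 4 ℕ.* c) r ⟧ ≤ ⟦ r ! ℕ.* r ! ⟧ * expTwoPiSqCOver3Approx c (suc r) r
    ⟦∏[k²+4c]⟧≤[r!]²*approx r = begin
      ⟦ prodUpTo (λ i → suc i ℕ.* suc i ℕ.+ 4 ℕ.* c) r ⟧
        ≡⟨ trans (⟦prodUpTo⟧ _ r) (∏ℚ-cong r ⟦[1+i]²+4c⟧≡⟦[1+i]²⟧*[1+y]) ⟩
      ∏ℚ (λ i → ⟦ suc i ℕ.* suc i ⟧ * (1ℚ + y i)) r
        ≡⟨ ∏ℚ-* _ _ r ⟩
      ∏ℚ (λ i → ⟦ suc i ℕ.* suc i ⟧) r * ∏ℚ (λ i → 1ℚ + y i) r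
        ≡⟨ cong (_* ∏ℚ (λ i → 1ℚ + y i) r) (trans (sym (⟦prodUpTo⟧ _ r)) (cong ⟦_⟧ ∏[1+i]²≡r!²)) ⟩
      ⟦ r ! ℕ.* r ! ⟧ * ∏ℚ (λ i → 1ℚ + y i) r
        ≤⟨ *-monoˡ-≤-nonNeg ⟦ r ! ℕ.* r ! ⟧ {{nonNegative (⟦⟧-nonNeg (r ! ℕ.* r !))}} (∏[1+y]≤expPartial[∑y] 0≤y r) ⟩
      ⟦ r ! ℕ.* r ! ⟧ * expPartial (suc r) (∑ℚ y r)
        ≡⟨ cong (λ t → ⟦ r ! ℕ.* r ! ⟧ * expPartial (suc r) t) (∑y≡approxArgument r) ⟩
      ⟦ r ! ℕ.* r ! ⟧ * expTwoPiSqCOver3Approx c (suc r) r ∎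
      where
      open ≤-Reasoning
      0≤y : ∀ i → 0ℚ ≤ y i
      0≤y i = nonNeg-* (⟦⟧-nonNeg (4 ℕ.* c)) (nonNeg-* (1/[1+n]-nonNeg i) (1/[1+n]-nonNeg i))
      ∏[1+i]²≡r!² : prodUpTo (λ i → suc i ℕ.* suc i) r ≡ r ! ℕ.* r !
      ∏[1+i]²≡r!² = trans (prodUpTo-* suc suc r) (cong₂ ℕ._*_ (prodUpTo-suc≡! r) (prodUpTo-suc≡! r))

  LeTimesExp-intro : ∀ {q} r c N M → q ≤ r * expTwoPiSqCOver3Approx c N M → LeTimesExp q r c
  LeTimesExp-intro r c N M q≤rE ε 0<ε =
    N , M , ≤-<-trans q≤rE (subst (_< rE + ε) (+-identityʳ rE) (+-monoʳ-< rE 0<ε))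
    where rE = r * expTwoPiSqCOver3Approx c N M


open import Defs
open import Data.Nat using (ℕ; suc; _*_; _+_; _∸_; _≤_; _!)
open import Data.Integer using (+_)
open import Data.Rational using (ℚ) renaming (_*_ to _*ℚ_)
open import Data.Product using (_×_)

open import Data.Nat.Properties using (+-∸-assoc; m+[n∸m]≡n; *-assoc)
open import Data.Nat.Divisibility using (_∣_; divides; ∣-trans; *-monoʳ-∣; n∣m*n)
open import Data.Nat.LCM using (lcm)
open import Data.Nat.ListAction using (product)
open import Data.List using (foldr; map; applyUpTo)
open import Data.List.Properties using (map-applyUpTo)
import Data.Integer.Properties as ℤ
open import Data.Rational using () renaming (_≤_ to _≤ℚ_)
open import Data.Product using (_,_)
open import Relation.Binary.PropositionalEquality
open import Data.Nat.Tactic.RingSolver using (solve-∀)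
open BigOperators using (prodUpTo; lcmUpTo)
open RationalEmbedding using (⟦*⟧; ⟦⟧-≤-*)
open SquaresExponentialBound using (⟦∏[k²+4c]⟧≤[r!]²*approx; LeTimesExp-intro)

map-range : ∀ {m n} (f : ℕ → ℕ) → m ≤ n → map f (range m n) ≡ applyUpTo (λ i → f (m + i)) (suc (n ∸ m))
map-range {m} f m≤n =
  trans (cong (λ k → map f (applyUpTo (λ i → m + i) k)) (+-∸-assoc 1 m≤n)) (map-applyUpTo (λ i → m + i) f _)

prodRange≡prodUpTo : ∀ {m n} f → m ≤ n → prodRange m n f ≡ prodUpTo (λ i → f (m + i)) (suc (n ∸ m))
prodRange≡prodUpTo f m≤n = cong product (map-range f m≤n)

prodRange-from-1 : ∀ f r → prodRange 1 r f ≡ prodUpTo (λ i → f (suc i)) r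
prodRange-from-1 f r = cong product (map-applyUpTo suc f r)

L≡lcmUpTo : ∀ c {m n} → m ≤ n → L c m n ≡ lcmUpTo (λ i → (m + i) * (m + i) + c) (suc (n ∸ m))
L≡lcmUpTo c m≤n = cong (foldr lcm 1) (map-range (λ k → k * k + c) m≤n)

IsMultipleOfFrac-intro : ∀ a {p} q → p ∣ a * q → IsMultipleOfFrac (+ a) p q
IsMultipleOfFrac-intro a {p} q (divides z a*q≡z*p) =
  + z , trans (sym (ℤ.pos-* a q)) (trans (cong +_ a*q≡z*p) (ℤ.pos-* z p))

module _ (c m n : ℕ) (1≤c : 1 ≤ c) (m≤n : m ≤ n) where

  open ShiftedSquares c m

  private
    r = n ∸ m
    ℓ = lcmUpTo a (suc r)
    Q = prodUpTo q r

  lcm-multiple : IsMultipleOfFrac (+ ℓ) (prodUpTo a (suc r)) (c * r ! * Q)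
  lcm-multiple = IsMultipleOfFrac-intro ℓ (c * r ! * Q)
    (∣-trans (∏a∣lcm*r!*∏q 1≤c r) (*-monoʳ-∣ ℓ (subst (r ! * Q ∣_) (sym (*-assoc c (r !) Q)) (n∣m*n c))))

  lcm-lower-bound : LeTimesExp ⟦ m * m * (n ! * n !) ⟧ (⟦ c * ℓ ⟧ *ℚ ⟦ m ! * m ! * (r ! * r ! * r !) ⟧) c
  lcm-lower-bound = LeTimesExp-intro (⟦ c * ℓ ⟧ *ℚ ⟦ m ! * m ! * (r ! * r ! * r !) ⟧) c (suc r) r bound
    where
    E = expTwoPiSqCOver3Approx c (suc r) r
    regroup : ∀ c l f t → c * l * (f * f * t) * (t * t) ≡ c * l * (f * f * (t * t * t))
    regroup = solve-∀
    ⟦⟧-regroup : ⟦ c * ℓ * (m ! * m ! * r !) * (r ! * r !) ⟧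
                   ≡ ⟦ c * ℓ ⟧ *ℚ ⟦ m ! * m ! * (r ! * r ! * r !) ⟧
    ⟦⟧-regroup = trans (cong ⟦_⟧ (regroup c ℓ (m !) (r !))) (⟦*⟧ (c * ℓ) _)
    bound : ⟦ m * m * (n ! * n !) ⟧ ≤ℚ ⟦ c * ℓ ⟧ *ℚ ⟦ m ! * m ! * (r ! * r ! * r !) ⟧ *ℚ E
    bound = subst₂ (λ k t → ⟦ m * m * (k ! * k !) ⟧ ≤ℚ t *ℚ E) (m+[n∸m]≡n m≤n) ⟦⟧-regroup
      (⟦⟧-≤-* (c * ℓ * (m ! * m ! * r !)) (r ! * r !)
        (m²[m+r]!²≤c*lcm*m!²*r!*∏q 1≤c r) (⟦∏[k²+4c]⟧≤[r!]²*approx c r))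

theorem4 : (c m n : ℕ) → 1 ≤ c → 1 ≤ m → m ≤ n →
    IsMultipleOfFrac (+ L c m n)
      (prodRange m n (λ k → k * k + c))
      (c * (n ∸ m) ! * prodRange 1 (n ∸ m) (λ k → k * k + 4 * c))
    × LeTimesExp (⟦ m * m * (n ! * n !) ⟧)
        (⟦ c * L c m n ⟧ *ℚ ⟦ m ! * m ! * ((n ∸ m) ! * (n ∸ m) ! * (n ∸ m) !) ⟧)
        c
theorem4 c m n 1≤c _ m≤n
  rewrite L≡lcmUpTo c m≤n
        | prodRange≡prodUpTo (λ k → k * k + c) m≤n
        | prodRange-from-1 (λ k → k * k + 4 * c) (n ∸ m)
  = lcm-multiple c m n 1≤c m≤n , lcm-lower-bound c m n 1≤c m≤n
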